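{- Let $G=(V,E,w)$ be a graph with non-negative edge-weights, let $s\in V$ and let $C$ be a cycle of $G$. Assume there is a vertex $x\in V(C)$ such that $\max_{v\in V(C)} dist_C(x,v)\ge dist_G(s,x)>0$. Then the minimum $t_0\ge 0$ such that $\mathtt{HBD}(G,s,t_0)$ detects a cycle satisfies $t_0\le w(C)$.
   Context: Graphs are finite, simple, connected and undirected. $w(C)$ is the total edge-weight of $C$; $dist_G$ and $dist_C$ are weighted shortest-path distances in $G$ and in the cycle $C$ respectively. The procedure $\mathtt{HBD}(G,s,t)$ is the following truncated Dijkstra search: set $d(v)=\infty$ for all $v$, $d(s)=0$, and a priority queue $Q=\{s\}$. While $Q\ne\emptyset$, extract $u\in Q$ with minimum $d(u)$ and scan the edges $uv$ incident to $u$ (other than the edge through which $u$ was discovered) in non-decreasing order of weight as long as $d(u)+w_{uv}\le t$; for each such edge: if $d(v)\neq\infty$, report a cycle and stop; otherwise set $d(v)=d(u)+w_{uv}$ and insert $v$ into $Q$. The procedure "detects a cycle" if it stops by reporting a cycle.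
   Formalization: The edge weights of G are rational, and the threshold t at which HBD(G,s,t) detects a cycle is taken in the rationals. -}

module Defs where

open import Data.Nat using (ℕ; zero; suc)
open import Data.Nat.DivMod using (_mod_)
open import Data.Fin using (Fin; toℕ; _≟_)
open import Data.Bool using (Bool; true; false; if_then_else_)
open import Data.Maybe using (Maybe; just; nothing)
open import Data.Rational using (ℚ; 0ℚ; _+_; _≤_; _<_)
open import Data.Product using (Σ; _×_; _,_)
open import Data.Sum using (_⊎_)
open import Function.Definitions using (Injective)
open import Relation.Nullary using (¬_; does)
open import Relation.Binary.PropositionalEquality using (_≡_; _≢_)
open import Relation.Binary.Construct.Closure.ReflexiveTransitive using (Star)

data Walk {V : Set} (E : V → V → Set) (w : V → V → ℚ) : V → V → ℚ → Set where
  []  : ∀ {u} → Walk E w u u 0ℚ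
  _∷_ : ∀ {u v x d} → E u v → Walk E w v x d → Walk E w u x (w u v + d)

IsDist : {V : Set} (E : V → V → Set) (w : V → V → ℚ) → V → V → ℚ → Set
IsDist E w u v d = Walk E w u v d × (∀ d' → Walk E w u v d' → d ≤ d')

record Graph : Set where
  field
    n       : ℕ
    adj     : Fin n → Fin n → Bool
    w       : Fin n → Fin n → ℚ
    adj-sym : ∀ u v → adj u v ≡ adj v u
    irrefl  : ∀ u → adj u u ≡ false
    w-sym   : ∀ u v → w u v ≡ w v u
    w-nonneg : ∀ u v → adj u v ≡ true → 0ℚ ≤ w u v
  Edge : Fin n → Fin n → Set
  Edge u v = adj u v ≡ true
  field
    connected : ∀ u v → Σ ℚ (λ d → Walk Edge w u v d)

open Graph public

DistG : (G : Graph) → Fin (n G) → Fin (n G) → ℚ → Set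
DistG G = IsDist (Edge G) (w G)

-- Cycles: c₀ c₁ … c_{k-1} distinct vertices, k ≥ 3, with c_i c_{i+1 mod k}
-- edges of G.  We write k = 3 + m.

len : ℕ → ℕ
len m = suc (suc (suc m))

next : ∀ {m} → Fin (len m) → Fin (len m)
next {m} i = suc (toℕ i) mod (len m)

record Cycle (G : Graph) : Set where
  field
    m      : ℕ
    c      : Fin (len m) → Fin (n G)
    c-inj  : Injective _≡_ _≡_ c
    c-edge : ∀ i → Edge G (c i) (c (next i))

open Cycle public

sumFin : ∀ {k} → (Fin k → ℚ) → ℚ
sumFin {zero}  f = 0ℚ
sumFin {suc k} f = f Fin.zero + sumFin (λ i → f (Fin.suc i))

weight : (G : Graph) → Cycle G → ℚ
weight G C = sumFin (λ i → w G (c C i) (c C (next i)))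

-- The cycle C viewed as a weighted graph on its positions Fin k:
-- i ~ j iff j = i+1 or i = j+1 (mod k), with the weights of G.
EdgeC : (G : Graph) (C : Cycle G) → Fin (len (m C)) → Fin (len (m C)) → Set
EdgeC G C i j = (j ≡ next i) ⊎ (i ≡ next j)

wC : (G : Graph) (C : Cycle G) → Fin (len (m C)) → Fin (len (m C)) → ℚ
wC G C i j = w G (c C i) (c C j)

DistC : (G : Graph) (C : Cycle G) → Fin (len (m C)) → Fin (len (m C)) → ℚ → Set
DistC G C = IsDist (EdgeC G C) (wC G C)

-- The procedure HBD(G,s,t) as a nondeterministic small-step machine
-- (nondeterminism = arbitrary tie-breaking in the queue and among
-- equal-weight edges).

upd : ∀ {n} {A : Set} → (Fin n → A) → Fin n → A → Fin n → A
upd f v a y = if does (y ≟ v) then a else f y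

data State (k : ℕ) : Set where
  report : State k
  -- d (nothing = ∞), parent (vertex through which discovered), Q membership
  idle   : (d : Fin k → Maybe ℚ) (par : Fin k → Maybe (Fin k)) (inQ : Fin k → Bool) → State k
  -- scanning the edges of u; 'done' marks the already scanned neighbours
  scan   : (d : Fin k → Maybe ℚ) (par : Fin k → Maybe (Fin k)) (inQ : Fin k → Bool)
           (u : Fin k) (done : Fin k → Bool) → State k

-- uv is an edge to be considered when scanning u (not the discovery edge of u)
Eligible : (G : Graph) (par : Fin (n G) → Maybe (Fin (n G))) → Fin (n G) → Fin (n G) → Set
Eligible G par u v = Edge G u v × (par u ≢ just v)

data Step (G : Graph) (t : ℚ) : State (n G) → State (n G) → Set where
  extract  : ∀ {d par inQ} u du →
             inQ u ≡ true → d u ≡ just du →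
             (∀ v dv → inQ v ≡ true → d v ≡ just dv → du ≤ dv) →
             Step G t (idle d par inQ) (scan d par (upd inQ u false) u (λ _ → false))
  detect   : ∀ {d par inQ u done} v du dv →
             d u ≡ just du → Eligible G par u v → done v ≡ false →
             (∀ v' → Eligible G par u v' → done v' ≡ false → w G u v ≤ w G u v') →
             du + w G u v ≤ t → d v ≡ just dv →
             Step G t (scan d par inQ u done) report
  discover : ∀ {d par inQ u done} v du →
             d u ≡ just du → Eligible G par u v → done v ≡ false →
             (∀ v' → Eligible G par u v' → done v' ≡ false → w G u v ≤ w G u v') →
             du + w G u v ≤ t → d v ≡ nothing →
             Step G t (scan d par inQ u done)
                      (scan (upd d v (just (du + w G u v))) (upd par v (just u))
                            (upd inQ v true) u (upd done v true))
  finish   : ∀ {d par inQ u done} du →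
             d u ≡ just du →
             (∀ v → Eligible G par u v → done v ≡ false → t < du + w G u v) →
             Step G t (scan d par inQ u done) (idle d par inQ)

initial : (G : Graph) → Fin (n G) → State (n G)
initial G s = idle (upd (λ _ → nothing) s (just 0ℚ)) (λ _ → nothing) (upd (λ _ → false) s true)

-- HBD(G,s,t) detects a cycle: every maximal run (whatever the tie-breaking)
-- stops by reporting a cycle.
Detects : (G : Graph) → Fin (n G) → ℚ → Set
Detects G s t = ∀ st → Star (Step G t) (initial G s) st →
                (∀ st' → ¬ Step G t st st') → st ≡ report

module Submission where

-- We prove the bound with t₀ = w(C): HBD(G, s, w(C)) detects a cycle.
--
-- Every run of HBD maintains a discovery forest (parent links
-- are edges, labels add up along them, ranks increase from parent to child)
-- and, for every fully scanned vertex, a closure property: each of its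
-- eligible edges within the threshold leads to a child.  Hence a run can only
-- stop without reporting when it is idle with an empty queue ("exhausted"),
-- and then every vertex within the threshold of s along a walk is reached,
-- each traversed edge being a parent link.  Let x = c_i with
-- dist_G(s, x) ≤ dist_C(x, c_j).  For an edge e of C, c_j lies on one of the
-- two arcs of C from x avoiding e, so going round C from x in the direction
-- of the other arc reaches e and crosses it within w(C).  Thus all edges of
-- C would be parent links, which is impossible since the ranks increase
-- along parent links.

open import Defs
open import Data.Nat as ℕ using (ℕ; zero; suc; _%_; _/_)
import Data.Nat.Properties as ℕP
open import Data.Nat.DivMod using (m%n<n; m%n%n≡m%n; %-distribˡ-+; [m+n]%n≡m%n; m<n⇒m%n≡m; m≡m%n+[m/n]*n)
open import Data.Fin as Fin using (Fin; toℕ; _≟_)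
import Data.Fin.Properties as FinP
open import Data.Bool using (Bool; true; false)
import Data.Bool as Bool
import Data.Bool.Properties as BoolP
open import Data.Maybe using (Maybe; just; nothing; fromMaybe)
open import Data.Maybe.Properties using (just-injective)
import Data.Maybe.Properties as MaybeP
open import Data.Rational using (ℚ; 0ℚ; _+_; _≤_; _<_)
open import Data.Rational.Properties
  using (≤-refl; ≤-trans; ≤-reflexive; <-irrefl; <-≤-trans; _≤?_; ≰⇒>; <⇒≤;
         +-identityˡ; +-identityʳ; +-assoc; +-comm; +-mono-≤; +-monoˡ-≤; +-monoʳ-≤)
open import Data.Product using (Σ; _×_; _,_; proj₁; proj₂)
open import Data.Sum using (_⊎_; inj₁; inj₂; swap)
open import Data.Empty using (⊥-elim)
open import Data.Unit using (⊤; tt)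
open import Relation.Nullary using (¬_; Dec; yes; no)
open import Relation.Nullary.Decidable using (¬?; _×-dec_)
open import Relation.Binary.PropositionalEquality
open import Relation.Binary.Construct.Closure.ReflexiveTransitive using (Star; ε; _◅_)

x≤x+y : ∀ x {y} → 0ℚ ≤ y → x ≤ x + y
x≤x+y x 0≤y = ≤-trans (≤-reflexive (sym (+-identityʳ x))) (+-monoʳ-≤ x 0≤y)

x+y≤z⇒x≤z : ∀ x {y z} → 0ℚ ≤ y → x + y ≤ z → x ≤ z
x+y≤z⇒x≤z x 0≤y x+y≤z = ≤-trans (x≤x+y x 0≤y) x+y≤z

nonneg-+ : ∀ {x y} → 0ℚ ≤ x → 0ℚ ≤ y → 0ℚ ≤ x + y
nonneg-+ 0≤x 0≤y = ≤-trans (≤-reflexive (sym (+-identityʳ 0ℚ))) (+-mono-≤ 0≤x 0≤y)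

edge-sym : (G : Graph) → ∀ {u v} → Edge G u v → Edge G v u
edge-sym G {u} {v} e = trans (sym (adj-sym G u v)) e

module WalkReversal {V : Set} (E : V → V → Set) (wt : V → V → ℚ)
                    (E-sym : ∀ {u v} → E u v → E v u) (wt-sym : ∀ u v → wt u v ≡ wt v u) where

  snoc : ∀ {u v x d} → Walk E wt u v d → E v x → Walk E wt u x (d + wt v x)
  snoc {u} {x = x} [] e =
    subst (Walk E wt u x) (trans (+-identityʳ (wt u x)) (sym (+-identityˡ (wt u x)))) (e ∷ [])
  snoc {x = x} (_∷_ {u} {v} {d = d} e ws) e' =
    subst (Walk E wt u x) (sym (+-assoc (wt u v) d _)) (e ∷ snoc ws e')

  reverse : ∀ {u v d} → Walk E wt u v d → Walk E wt v u d
  reverse [] = []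
  reverse (_∷_ {u} {v} {d = d} e ws) = subst (Walk E wt _ u) reordered (snoc (reverse ws) (E-sym e))
    where
    reordered : d + wt v u ≡ wt u v + d
    reordered = trans (+-comm d (wt v u)) (cong (_+ d) (wt-sym v u))

walk-nonneg : (G : Graph) → ∀ {u v d} → Walk (Edge G) (w G) u v d → 0ℚ ≤ d
walk-nonneg G [] = ≤-refl
walk-nonneg G (_∷_ {u} {v} e ws) = nonneg-+ (w-nonneg G u v e) (walk-nonneg G ws)

upd-same : ∀ {k} {A : Set} (f : Fin k → A) v a → upd f v a v ≡ a
upd-same f v a with v ≟ v
... | yes _ = refl
... | no v≢v = ⊥-elim (v≢v refl)

upd-other : ∀ {k} {A : Set} (f : Fin k → A) v a y → y ≢ v → upd f v a y ≡ f y
upd-other f v a y y≢v with y ≟ v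
... | yes y≡v = ⊥-elim (y≢v y≡v)
... | no _ = refl

-- A minimiser of f among the elements of Fin k satisfying a decidable P,
-- unless P is empty; this is how HBD's choices are shown to exist.
argmin : ∀ {k} (P : Fin k → Set) → (∀ x → Dec (P x)) → (f : Fin k → ℚ) →
         (∀ x → ¬ P x) ⊎ Σ (Fin k) (λ x → P x × (∀ y → P y → f x ≤ f y))
argmin {zero} P P? f = inj₁ (λ ())
argmin {suc k} P P? f with argmin (λ x → P (Fin.suc x)) (λ x → P? (Fin.suc x)) (λ x → f (Fin.suc x)) | P? Fin.zero
... | inj₁ none | yes p0 = inj₂ (Fin.zero , p0 , λ { Fin.zero _ → ≤-refl ; (Fin.suc y) py → ⊥-elim (none y py) })
... | inj₁ none | no ¬p0 = inj₁ (λ { Fin.zero p → ¬p0 p ; (Fin.suc y) py → none y py })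
... | inj₂ (x , px , min) | no ¬p0 =
  inj₂ (Fin.suc x , px , λ { Fin.zero p → ⊥-elim (¬p0 p) ; (Fin.suc y) py → min y py })
... | inj₂ (x , px , min) | yes p0 with f Fin.zero ≤? f (Fin.suc x)
...   | yes f0≤ = inj₂ (Fin.zero , p0 , λ { Fin.zero _ → ≤-refl ; (Fin.suc y) py → ≤-trans f0≤ (min y py) })
...   | no f0≰ = inj₂ (Fin.suc x , px , λ { Fin.zero _ → <⇒≤ (≰⇒> f0≰) ; (Fin.suc y) py → min y py })

argmax : ∀ {k} (f : Fin (suc k) → ℕ) → Σ (Fin (suc k)) (λ x → ∀ y → f y ℕ.≤ f x)
argmax {zero} f = Fin.zero , λ { Fin.zero → ℕP.≤-refl }
argmax {suc k} f with argmax (λ x → f (Fin.suc x))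
... | x , max with f Fin.zero ℕ.≤? f (Fin.suc x)
...   | yes f0≤ = Fin.suc x , λ { Fin.zero → f0≤ ; (Fin.suc y) → max y }
...   | no f0≰ = Fin.zero , λ { Fin.zero → ℕP.≤-refl ; (Fin.suc y) → ℕP.≤-trans (max y) (ℕP.<⇒≤ (ℕP.≰⇒> f0≰)) }

Linked : ∀ {k} → (Fin k → Maybe (Fin k)) → Fin k → Fin k → Set
Linked par u v = par v ≡ just u ⊎ par u ≡ just v

module CyclicPositions (r : ℕ) where

  k : ℕ
  k = len r

  advance : Fin k → ℕ → Fin k
  advance p zero = p
  advance p (suc l) = advance (next p) l

  advance-+ : ∀ p a b → advance p (a ℕ.+ b) ≡ advance (advance p a) b
  advance-+ p zero b = refl
  advance-+ p (suc a) b = advance-+ (next p) a b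

  advance-suc : ∀ p l → advance p (suc l) ≡ next (advance p l)
  advance-suc p zero = refl
  advance-suc p (suc l) = advance-suc (next p) l

  toℕ-advance : ∀ p l → toℕ (advance p l) ≡ (toℕ p ℕ.+ l) % k
  toℕ-advance p zero =
    sym (trans (cong (_% k) (ℕP.+-identityʳ (toℕ p))) (m<n⇒m%n≡m (FinP.toℕ<n p)))
  toℕ-advance p (suc l) = begin
    toℕ (advance (next p) l)                ≡⟨ toℕ-advance (next p) l ⟩
    (toℕ (next p) ℕ.+ l) % k                ≡⟨ cong (λ z → (z ℕ.+ l) % k) (FinP.toℕ-fromℕ< (m%n<n (suc (toℕ p)) k)) ⟩
    (suc (toℕ p) % k ℕ.+ l) % k             ≡⟨ %-distribˡ-+ (suc (toℕ p) % k) l k ⟩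
    (suc (toℕ p) % k % k ℕ.+ l % k) % k     ≡⟨ cong (λ z → (z ℕ.+ l % k) % k) (m%n%n≡m%n (suc (toℕ p)) k) ⟩
    (suc (toℕ p) % k ℕ.+ l % k) % k         ≡⟨ sym (%-distribˡ-+ (suc (toℕ p)) l k) ⟩
    (suc (toℕ p) ℕ.+ l) % k                 ≡⟨ cong (_% k) (sym (ℕP.+-suc (toℕ p) l)) ⟩
    (toℕ p ℕ.+ suc l) % k                   ∎
    where open ≡-Reasoning

  advance-period : ∀ p → advance p k ≡ p
  advance-period p = FinP.toℕ-injective
    (trans (toℕ-advance p k) (trans ([m+n]%n≡m%n (toℕ p) k) (m<n⇒m%n≡m (FinP.toℕ<n p))))

  advance-from-zero : ∀ i → advance Fin.zero (toℕ i) ≡ i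
  advance-from-zero i = FinP.toℕ-injective (trans (toℕ-advance Fin.zero (toℕ i)) (m<n⇒m%n≡m (FinP.toℕ<n i)))

  advance-onto : ∀ i j → Σ ℕ λ l → l ℕ.< k × advance i l ≡ j
  advance-onto i j = l , m%n<n (toℕ j ℕ.+ x) k , FinP.toℕ-injective reaches
    where
    x = k ℕ.∸ toℕ i
    l = (toℕ j ℕ.+ x) % k
    reaches : toℕ (advance i l) ≡ toℕ j
    reaches = begin
      toℕ (advance i l)                    ≡⟨ toℕ-advance i l ⟩
      (toℕ i ℕ.+ l) % k                    ≡⟨ %-distribˡ-+ (toℕ i) l k ⟩
      (toℕ i % k ℕ.+ l % k) % k            ≡⟨ cong (λ z → (toℕ i % k ℕ.+ z) % k) (m%n%n≡m%n (toℕ j ℕ.+ x) k) ⟩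
      (toℕ i % k ℕ.+ (toℕ j ℕ.+ x) % k) % k ≡⟨ sym (%-distribˡ-+ (toℕ i) (toℕ j ℕ.+ x) k) ⟩
      (toℕ i ℕ.+ (toℕ j ℕ.+ x)) % k        ≡⟨ cong (_% k) (ℕP.+-comm (toℕ i) (toℕ j ℕ.+ x)) ⟩
      (toℕ j ℕ.+ x ℕ.+ toℕ i) % k          ≡⟨ cong (_% k) (ℕP.+-assoc (toℕ j) x (toℕ i)) ⟩
      (toℕ j ℕ.+ (x ℕ.+ toℕ i)) % k        ≡⟨ cong (λ z → (toℕ j ℕ.+ z) % k) (ℕP.m∸n+n≡m (ℕP.<⇒≤ (FinP.toℕ<n i))) ⟩
      (toℕ j ℕ.+ k) % k                    ≡⟨ [m+n]%n≡m%n (toℕ j) k ⟩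
      toℕ j % k                            ≡⟨ m<n⇒m%n≡m (FinP.toℕ<n j) ⟩
      toℕ j                                ∎
      where open ≡-Reasoning

  -- Since k ≥ 3, two steps onwards never return to the start.
  next-next≢ : ∀ p → next (next p) ≢ p
  next-next≢ p returns = no-multiple (P / k) (sym (ℕP.+-cancelˡ-≡ (toℕ p) 2 ((P / k) ℕ.* k) division))
    where
    P = toℕ p ℕ.+ 2
    division : toℕ p ℕ.+ 2 ≡ toℕ p ℕ.+ (P / k) ℕ.* k
    division = trans (m≡m%n+[m/n]*n P k)
                     (cong (ℕ._+ (P / k) ℕ.* k) (trans (sym (toℕ-advance p 2)) (cong toℕ returns)))
    no-multiple : ∀ q → q ℕ.* k ≢ 2
    no-multiple zero ()
    no-multiple (suc q) ()

  remaining-steps : ∀ {a} → a ℕ.< k → Σ ℕ λ b → a ℕ.+ suc b ≡ k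
  remaining-steps {a} a<k with ℕP.m≤n⇒∃[o]m+o≡n a<k
  ... | b , 1+a+b≡k = b , trans (ℕP.+-suc a b) 1+a+b≡k

  full-turn : ∀ i a b → a ℕ.+ suc b ≡ k → advance (next (advance i a)) b ≡ i
  full-turn i a b a+1+b≡k = begin
    advance (next (advance i a)) b ≡⟨ cong (λ z → advance z b) (sym (advance-suc i a)) ⟩
    advance (advance i (suc a)) b  ≡⟨ sym (advance-+ i (suc a) b) ⟩
    advance i (suc a ℕ.+ b)        ≡⟨ cong (advance i) (trans (sym (ℕP.+-suc a b)) a+1+b≡k) ⟩
    advance i k                    ≡⟨ advance-period i ⟩
    i                              ∎
    where open ≡-Reasoning

  prev : Fin k → Fin k
  prev p = advance p (suc (suc r))

  next-prev : ∀ p → next (prev p) ≡ p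
  next-prev p = trans (sym (advance-suc p (suc (suc r)))) (advance-period p)

sumℕ : (ℕ → ℚ) → ℕ → ℚ
sumℕ h zero = 0ℚ
sumℕ h (suc l) = h 0 + sumℕ (λ q → h (suc q)) l

sumFin≡sumℕ : ∀ {N} (f : Fin N → ℚ) (h : ℕ → ℚ) → (∀ x → f x ≡ h (toℕ x)) → sumFin f ≡ sumℕ h N
sumFin≡sumℕ {zero} f h f≡h = refl
sumFin≡sumℕ {suc N} f h f≡h =
  cong₂ _+_ (f≡h Fin.zero) (sumFin≡sumℕ (λ x → f (Fin.suc x)) (λ q → h (suc q)) (λ x → f≡h (Fin.suc x)))

module CycleArcs (G : Graph) (C : Cycle G) where
  open CyclicPositions (m C) public

  cw : Fin k → ℚ
  cw p = w G (c C p) (c C (next p))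

  cw-nonneg : ∀ p → 0ℚ ≤ cw p
  cw-nonneg p = w-nonneg G _ _ (c-edge C p)

  arc : Fin k → ℕ → ℚ
  arc p zero = 0ℚ
  arc p (suc l) = cw p + arc (next p) l

  arc-nonneg : ∀ p l → 0ℚ ≤ arc p l
  arc-nonneg p zero = ≤-refl
  arc-nonneg p (suc l) = nonneg-+ (cw-nonneg p) (arc-nonneg (next p) l)

  arc-+ : ∀ p a b → arc p (a ℕ.+ b) ≡ arc p a + arc (advance p a) b
  arc-+ p zero b = sym (+-identityˡ _)
  arc-+ p (suc a) b = trans (cong (cw p +_) (arc-+ (next p) a b)) (sym (+-assoc (cw p) _ _))

  arc-prefix : ∀ p a b → arc p a ≤ arc p (a ℕ.+ b)
  arc-prefix p a b = ≤-trans (x≤x+y (arc p a) (arc-nonneg (advance p a) b)) (≤-reflexive (sym (arc-+ p a b)))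

  arc-suffix : ∀ p a b → arc (advance p a) b ≤ arc p (a ℕ.+ b)
  arc-suffix p a b =
    ≤-trans (≤-trans (≤-reflexive (sym (+-identityˡ _))) (+-monoˡ-≤ (arc (advance p a) b) (arc-nonneg p a)))
            (≤-reflexive (sym (arc-+ p a b)))

  arc-sumℕ : ∀ p l → arc p l ≡ sumℕ (λ q → cw (advance p q)) l
  arc-sumℕ p zero = refl
  arc-sumℕ p (suc l) = cong (cw p +_) (arc-sumℕ (next p) l)

  arc-rotate : ∀ p → arc (next p) k ≡ arc p k
  arc-rotate p = begin
    arc (next p) k                        ≡⟨ cong (arc (next p)) (ℕP.+-comm 1 k′) ⟩
    arc (next p) (k′ ℕ.+ 1)               ≡⟨ arc-+ (next p) k′ 1 ⟩
    arc (next p) k′ + (cw (advance p k) + 0ℚ) ≡⟨ cong (λ z → arc (next p) k′ + (cw z + 0ℚ)) (advance-period p) ⟩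
    arc (next p) k′ + (cw p + 0ℚ)         ≡⟨ cong (arc (next p) k′ +_) (+-identityʳ (cw p)) ⟩
    arc (next p) k′ + cw p                ≡⟨ +-comm (arc (next p) k′) (cw p) ⟩
    arc p k                               ∎
    where
    open ≡-Reasoning
    k′ = suc (suc (m C))

  arc-turn : ∀ p l → arc (advance p l) k ≡ arc p k
  arc-turn p zero = refl
  arc-turn p (suc l) = trans (arc-turn (next p) l) (arc-rotate p)

  weight≡arc : ∀ i → weight G C ≡ arc i k
  weight≡arc i = begin
    weight G C                       ≡⟨ sumFin≡sumℕ cw (λ q → cw (advance Fin.zero q)) (λ x → cong cw (sym (advance-from-zero x))) ⟩
    sumℕ (λ q → cw (advance Fin.zero q)) k ≡⟨ sym (arc-sumℕ Fin.zero k) ⟩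
    arc Fin.zero k                   ≡⟨ sym (arc-turn Fin.zero (toℕ i)) ⟩
    arc (advance Fin.zero (toℕ i)) k ≡⟨ cong (λ z → arc z k) (advance-from-zero i) ⟩
    arc i k                          ∎
    where open ≡-Reasoning

  weight-nonneg : 0ℚ ≤ weight G C
  weight-nonneg = ≤-trans (arc-nonneg Fin.zero k) (≤-reflexive (sym (weight≡arc Fin.zero)))

  weight-split : ∀ i a b → a ℕ.+ suc b ≡ k →
                 weight G C ≡ arc i a + (cw (advance i a) + arc (next (advance i a)) b)
  weight-split i a b a+1+b≡k =
    trans (weight≡arc i) (trans (cong (arc i) (sym a+1+b≡k)) (arc-+ i a (suc b)))

  arcC : ∀ p l → Walk (EdgeC G C) (wC G C) p (advance p l) (arc p l)
  arcC p zero = []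
  arcC p (suc l) = inj₁ refl ∷ arcC (next p) l

  arcG : ∀ p l → Walk (Edge G) (w G) (c C p) (c C (advance p l)) (arc p l)
  arcG p zero = []
  arcG p (suc l) = c-edge C p ∷ arcG (next p) l

  module RevC = WalkReversal (EdgeC G C) (wC G C) swap (λ u v → w-sym G (c C u) (c C v))
  module RevG = WalkReversal (Edge G) (w G) (edge-sym G) (w-sym G)

  distC-≤-arc : ∀ {i l d} → DistC G C i (advance i l) d → d ≤ arc i l
  distC-≤-arc {i} {l} dist = proj₂ dist _ (arcC i l)

  distC-≤-weight : ∀ {i j d} → DistC G C i j d → d ≤ weight G C
  distC-≤-weight {i} {j} dist with advance-onto i j
  ... | l , l<k , refl = ≤-trans (distC-≤-arc {l = l} dist)
        (≤-trans (arc-prefix i l (k ℕ.∸ l))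
                 (≤-reflexive (trans (cong (arc i) (ℕP.m+[n∸m]≡n (ℕP.<⇒≤ l<k))) (sym (weight≡arc i)))))

  distC-≤-one-arc : ∀ {i j d} a b → a ℕ.+ suc b ≡ k → DistC G C i j d →
                    d ≤ arc i a ⊎ d ≤ arc (next (advance i a)) b
  distC-≤-one-arc {i} {j} a b a+1+b≡k dist with advance-onto i j
  ... | l , l<k , refl with l ℕ.≤? a
  ...   | yes l≤a with ℕP.m≤n⇒∃[o]m+o≡n l≤a
  ...     | e , l+e≡a = inj₁ (≤-trans (distC-≤-arc {l = l} dist)
                                    (≤-trans (arc-prefix i l e) (≤-reflexive (cong (arc i) l+e≡a))))
  distC-≤-one-arc {i} a b a+1+b≡k dist | l , l<k , refl | no l≰a
    with ℕP.m≤n⇒∃[o]m+o≡n (ℕP.≰⇒> l≰a)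
  ... | e , 1+a+e≡l = inj₂ (≤-trans (proj₂ dist _ back) (≤-trans (arc-suffix q′ e f) (≤-reflexive (cong (arc q′) e+f≡b))))
    where
    q′ = next (advance i a)
    e≤b : e ℕ.≤ b
    e≤b = ℕP.≤-pred (ℕP.+-cancelˡ-≤ a (suc e) (suc b)
            (subst₂ ℕ._≤_ (trans (sym 1+a+e≡l) (sym (ℕP.+-suc a e))) (sym a+1+b≡k) (ℕP.<⇒≤ l<k)))
    f = proj₁ (ℕP.m≤n⇒∃[o]m+o≡n e≤b)
    e+f≡b : e ℕ.+ f ≡ b
    e+f≡b = proj₂ (ℕP.m≤n⇒∃[o]m+o≡n e≤b)
    -- position j is e+1 steps after q and f steps before i
    j≡ : advance q′ e ≡ advance i l
    j≡ = trans (cong (λ z → advance z e) (sym (advance-suc i a)))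
               (trans (sym (advance-+ i (suc a) e)) (cong (advance i) 1+a+e≡l))
    returns : advance (advance q′ e) f ≡ i
    returns = trans (sym (advance-+ q′ e f)) (trans (cong (advance q′) e+f≡b) (full-turn i a b a+1+b≡k))
    back : Walk (EdgeC G C) (wC G C) i (advance i l) (arc (advance q′ e) f)
    back = subst₂ (λ x y → Walk (EdgeC G C) (wC G C) x y (arc (advance q′ e) f)) returns j≡
                  (RevC.reverse (arcC (advance q′ e) f))

module CycleLinks (G : Graph) (C : Cycle G) where
  open CycleArcs G C

  -- Parent pointers whose ranks increase from parent to child cannot link
  -- every pair of consecutive vertices of C: at a vertex of maximal rank both
  -- cycle neighbours would have to be its parent.
  no-linked-cycle : (par : Fin (n G) → Maybe (Fin (n G))) (rank : Fin (n G) → ℕ) →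
                    (∀ v p → par v ≡ just p → rank p ℕ.< rank v) →
                    ¬ (∀ q → Linked par (c C q) (c C (next q)))
  no-linked-cycle par rank grows linked with argmax (λ q → rank (c C q))
  ... | top , maximal with linked top | linked (prev top)
  ...   | inj₁ next-child | _ = ℕP.<⇒≱ (grows _ _ next-child) (maximal (next top))
  ...   | inj₂ _ | inj₂ prev-child =
    ℕP.<⇒≱ (grows _ _ (subst (λ z → par (c C (prev top)) ≡ just (c C z)) (next-prev top) prev-child)) (maximal (prev top))
  ...   | inj₂ next-parent | inj₁ prev-parent = next-next≢ (prev top) (trans (cong next (next-prev top)) next≡prev)
    where
    prev-parent′ : par (c C top) ≡ just (c C (prev top))
    prev-parent′ = subst (λ z → par (c C z) ≡ just (c C (prev top))) (next-prev top) prev-parent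
    next≡prev : next top ≡ prev top
    next≡prev = c-inj C (just-injective (trans (sym next-parent) prev-parent′))

module HBD (G : Graph) (s : Fin (n G)) (t : ℚ) where

  V : Set
  V = Fin (n G)

  Reached : (V → Maybe ℚ) → V → Set
  Reached d v = Σ ℚ λ dv → d v ≡ just dv

  -- The labels and parent pointers form a forest rooted at s: a parent link
  -- p → v is an edge with d(v) = d(p) + w(p v), and ranks (discovery times,
  -- all below clock) increase from parent to child.
  record Forest (d : V → Maybe ℚ) (par : V → Maybe V) (inQ : V → Bool) : Set where
    field
      rank : V → ℕ
      clock : ℕ
      source : d s ≡ just 0ℚ
      queued-reached : ∀ v → inQ v ≡ true → Reached d v
      parent-label : ∀ v p → par v ≡ just p → Σ ℚ λ dp → d p ≡ just dp × d v ≡ just (dp + w G p v)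
      parent-rank : ∀ v p → par v ≡ just p → rank p ℕ.< rank v
      rank-fresh : ∀ v dv → d v ≡ just dv → rank v ℕ.< clock
  open Forest public

  -- Every reached, dequeued vertex u with Scanned u has been fully scanned:
  -- each eligible edge u v within the threshold made u the parent of v.
  Closed : (d : V → Maybe ℚ) (par : V → Maybe V) (inQ : V → Bool) (Scanned : V → Set) → Set
  Closed d par inQ Scanned = ∀ u du v → Scanned u → d u ≡ just du → inQ u ≡ false →
                             Eligible G par u v → du + w G u v ≤ t → par v ≡ just u

  record Scanning (d : V → Maybe ℚ) (par : V → Maybe V) (inQ : V → Bool) (u : V) (done : V → Bool) : Set where
    field
      forest : Forest d par inQ
      closed : Closed d par inQ (_≢ u)
      current-reached : Reached d u
      current-dequeued : inQ u ≡ false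
      done-children : ∀ v → done v ≡ true → par v ≡ just u

  Inv : State (n G) → Set
  Inv report = ⊤
  Inv (idle d par inQ) = Forest d par inQ × Closed d par inQ (λ _ → ⊤)
  Inv (scan d par inQ u done) = Scanning d par inQ u done

  reached≢unreached : ∀ {d : V → Maybe ℚ} {y v dy} → d y ≡ just dy → d v ≡ nothing → y ≢ v
  reached≢unreached dy≡ dv≡ refl with trans (sym dy≡) dv≡
  ... | ()

  inv-initial : Inv (initial G s)
  inv-initial = forest₀ , closed₀
    where
    d₀ = upd (λ _ → nothing) s (just 0ℚ)
    inQ₀ = upd (λ _ → false) s true
    forest₀ : Forest d₀ (λ _ → nothing) inQ₀
    rank forest₀ _ = 0
    clock forest₀ = 1
    source forest₀ = upd-same _ s _
    queued-reached forest₀ v v∈Q with v ≟ s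
    ... | yes refl = 0ℚ , refl
    ... | no _ with () ← v∈Q
    parent-label forest₀ v p ()
    parent-rank forest₀ v p ()
    rank-fresh forest₀ v dv _ = ℕ.s≤s ℕ.z≤n
    closed₀ : Closed d₀ (λ _ → nothing) inQ₀ (λ _ → ⊤)
    closed₀ u du v _ du≡ u∉Q _ _ with u ≟ s
    ... | yes refl with () ← u∉Q
    ... | no _ with () ← du≡

  forest-dequeue : ∀ {d par inQ} u → Forest d par inQ → Forest d par (upd inQ u false)
  forest-dequeue {inQ = inQ} u F = record
    { rank = rank F ; clock = clock F ; source = source F
    ; queued-reached = λ v v∈Q → queued-reached F v (still-queued v v∈Q)
    ; parent-label = parent-label F ; parent-rank = parent-rank F ; rank-fresh = rank-fresh F
    }
    where
    still-queued : ∀ v → upd inQ u false v ≡ true → inQ v ≡ true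
    still-queued v v∈Q with v ≟ u
    ... | yes refl with () ← v∈Q
    ... | no _ = v∈Q

  forest-discover : ∀ {d par inQ u du v} → Forest d par inQ → d u ≡ just du → d v ≡ nothing →
    Forest (upd d v (just (du + w G u v))) (upd par v (just u)) (upd inQ v true)
  forest-discover {d} {par} {inQ} {u} {du} {v} F du≡ dv≡ = record
    { rank = upd (rank F) v (clock F)
    ; clock = suc (clock F)
    ; source = trans (upd-other d v _ s (reached≢unreached (source F) dv≡)) (source F)
    ; queued-reached = queued
    ; parent-label = label
    ; parent-rank = ranks
    ; rank-fresh = fresh
    }
    where
    u≢v : u ≢ v
    u≢v = reached≢unreached du≡ dv≡
    queued : ∀ y → upd inQ v true y ≡ true → Reached (upd d v (just (du + w G u v))) y
    queued y y∈Q with y ≟ v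
    ... | yes refl = _ , refl
    ... | no _ = queued-reached F y y∈Q
    label : ∀ y p → upd par v (just u) y ≡ just p → Σ ℚ λ dp →
            upd d v (just (du + w G u v)) p ≡ just dp × upd d v (just (du + w G u v)) y ≡ just (dp + w G p y)
    label y p py≡ with y ≟ v
    label y p refl | yes refl = du , trans (upd-other d v _ u u≢v) du≡ , refl
    ... | no _ with parent-label F y p py≡
    ...   | dp , dp≡ , dy≡ = dp , trans (upd-other d v _ p (reached≢unreached dp≡ dv≡)) dp≡ , dy≡
    ranks : ∀ y p → upd par v (just u) y ≡ just p → upd (rank F) v (clock F) p ℕ.< upd (rank F) v (clock F) y
    ranks y p py≡ with y ≟ v
    ranks y p refl | yes refl = subst (ℕ._< clock F) (sym (upd-other (rank F) v _ u u≢v)) (rank-fresh F u du du≡)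
    ... | no _ with parent-label F y p py≡
    ...   | dp , dp≡ , _ = subst (ℕ._< rank F y) (sym (upd-other (rank F) v _ p (reached≢unreached dp≡ dv≡)))
                                 (parent-rank F y p py≡)
    fresh : ∀ y dy → upd d v (just (du + w G u v)) y ≡ just dy → upd (rank F) v (clock F) y ℕ.< suc (clock F)
    fresh y dy dy≡ with y ≟ v
    ... | yes refl = ℕP.n<1+n (clock F)
    ... | no _ = ℕP.m<n⇒m<1+n (rank-fresh F y dy dy≡)

  closed-discover : ∀ {d par inQ u du v} → Forest d par inQ → Closed d par inQ (_≢ u) → d v ≡ nothing →
    Closed (upd d v (just (du + w G u v))) (upd par v (just u)) (upd inQ v true) (_≢ u)
  closed-discover {d} {par} {inQ} {u} {du} {v} F closedF dv≡ u′ du′ v′ u′≢u du′≡ u′∉Q (e , not-parent) within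
    with u′ ≟ v
  ... | yes refl with () ← u′∉Q
  ... | no _ with closedF u′ du′ v′ u′≢u du′≡ u′∉Q (e , not-parent) within
  ...   | link with parent-label F v′ u′ link
  ...     | _ , _ , dv′≡ = trans (upd-other par v _ v′ (reached≢unreached dv′≡ dv≡)) link

  -- Finishing u extends the closure to u itself: its scanned neighbours are
  -- children, and its unscanned eligible edges exceed the threshold.
  closed-finish : ∀ {d par inQ u done du} → Scanning d par inQ u done → d u ≡ just du →
    (∀ v → Eligible G par u v → done v ≡ false → t < du + w G u v) → Closed d par inQ (λ _ → ⊤)
  closed-finish {u = u} {done} S du≡ beyond u′ du′ v _ du′≡ u′∉Q elig within with u′ ≟ u
  ... | no u′≢u = Scanning.closed S u′ du′ v u′≢u du′≡ u′∉Q elig within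
  ... | yes refl with done v Bool.≟ true
  ...   | yes scanned = Scanning.done-children S v scanned
  ...   | no unscanned with just-injective (trans (sym du′≡) du≡)
  ...     | refl = ⊥-elim (<-irrefl refl (<-≤-trans (beyond v elig (BoolP.¬-not unscanned)) within))

  inv-step : ∀ {st st′} → Step G t st st′ → Inv st → Inv st′
  inv-step {idle d par inQ} (extract u du _ du≡ _) (F , closedF) = record
    { forest = forest-dequeue u F
    ; closed = λ u′ du′ v u′≢u du′≡ u′∉Q →
                 closedF u′ du′ v tt du′≡ (trans (sym (upd-other inQ u false u′ u′≢u)) u′∉Q)
    ; current-reached = du , du≡
    ; current-dequeued = upd-same inQ u false
    ; done-children = λ v ()
    }
  inv-step (detect _ _ _ _ _ _ _ _ _) _ = tt
  inv-step {scan d par inQ u done} (discover v du du≡ _ _ _ _ dv≡) S = record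
    { forest = forest-discover (Scanning.forest S) du≡ dv≡
    ; closed = closed-discover {du = du} (Scanning.forest S) (Scanning.closed S) dv≡
    ; current-reached = du , trans (upd-other d v _ u u≢v) du≡
    ; current-dequeued = trans (upd-other inQ v true u u≢v) (Scanning.current-dequeued S)
    ; done-children = children
    }
    where
    u≢v : u ≢ v
    u≢v = reached≢unreached du≡ dv≡
    children : ∀ y → upd done v true y ≡ true → upd par v (just u) y ≡ just u
    children y y-done with y ≟ v
    ... | yes refl = refl
    ... | no _ = Scanning.done-children S y y-done
  inv-step (finish du du≡ beyond) S = Scanning.forest S , closed-finish S du≡ beyond

  inv-run : ∀ {st} → Star (Step G t) (initial G s) st → Inv st
  inv-run = go inv-initial
    where
    go : ∀ {a b} → Inv a → Star (Step G t) a b → Inv b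
    go i ε = i
    go i (step ◅ steps) = go (inv-step step i) steps

  candidate? : (par : V → Maybe V) (u : V) (done : V → Bool) (v : V) → Dec (Eligible G par u v × done v ≡ false)
  candidate? par u done v =
    ((adj G u v Bool.≟ true) ×-dec ¬? (MaybeP.≡-dec _≟_ (par u) (just v))) ×-dec (done v Bool.≟ false)

  scan-progress : ∀ {d par inQ u done} → Scanning d par inQ u done →
                  Σ (State (n G)) (Step G t (scan d par inQ u done))
  scan-progress {d} {par} {inQ} {u} {done} S with Scanning.current-reached S
  ... | du , du≡ with argmin (λ v → Eligible G par u v × done v ≡ false) (candidate? par u done) (w G u)
  ...   | inj₁ none = _ , finish du du≡ (λ v elig fresh → ⊥-elim (none v (elig , fresh)))
  ...   | inj₂ (v , (elig , fresh) , lightest) with (du + w G u v) ≤? t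
  ...     | no over = _ , finish du du≡ (λ v′ elig′ fresh′ →
                            <-≤-trans (≰⇒> over) (+-monoʳ-≤ du (lightest v′ (elig′ , fresh′))))
  ...     | yes within with d v in dv≡
  ...       | nothing = _ , discover v du du≡ elig fresh (λ v′ e′ f′ → lightest v′ (e′ , f′)) within dv≡
  ...       | just dv = _ , detect v du dv du≡ elig fresh (λ v′ e′ f′ → lightest v′ (e′ , f′)) within dv≡

  -- An idle state with an empty queue, with its invariant: the only way for
  -- HBD to stop without reporting a cycle.
  record Exhausted : Set where
    field
      d : V → Maybe ℚ
      par : V → Maybe V
      inQ : V → Bool
      forest : Forest d par inQ
      closed : Closed d par inQ (λ _ → ⊤)
      queue-empty : ∀ v → inQ v ≡ false

  halts : ∀ st → Inv st → (∀ st′ → ¬ Step G t st st′) → st ≡ report ⊎ Exhausted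
  halts report _ _ = inj₁ refl
  halts (idle d par inQ) (F , closedF) stuck
    with argmin (λ v → inQ v ≡ true) (λ v → inQ v Bool.≟ true) (λ v → fromMaybe 0ℚ (d v))
  ... | inj₁ empty = inj₂ (record { forest = F ; closed = closedF ; queue-empty = λ v → BoolP.¬-not (empty v) })
  ... | inj₂ (u , u∈Q , nearest) with queued-reached F u u∈Q
  ...   | du , du≡ = ⊥-elim (stuck _ (extract u du u∈Q du≡ λ v dv v∈Q dv≡ →
                       subst₂ _≤_ (cong (fromMaybe 0ℚ) du≡) (cong (fromMaybe 0ℚ) dv≡) (nearest v v∈Q)))
  halts (scan _ _ _ _ _) S stuck = ⊥-elim (stuck _ (proj₂ (scan-progress S)))

  detects-unless-exhausted : ¬ Exhausted → Detects G s t
  detects-unless-exhausted never st run stuck with halts st (inv-run run) stuck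
  ... | inj₁ reported = reported
  ... | inj₂ ex = ⊥-elim (never ex)

  module Exhaustion (ex : Exhausted) where
    open Exhausted ex

    Within : V → ℚ → Set
    Within v b = Σ ℚ λ dv → d v ≡ just dv × dv ≤ b

    within-source : Within s 0ℚ
    within-source = 0ℚ , source forest , ≤-refl

    budget-edge : ∀ {u v b} → Within u b → Edge G u v → b + w G u v ≤ t →
                  Within v (b + w G u v) × Linked par u v
    budget-edge {u} {v} {b} (du , du≡ , du≤b) e within with MaybeP.≡-dec _≟_ (par u) (just v)
    ... | yes pu≡v with parent-label forest u v pu≡v
    ...   | dv , dv≡ , du≡′ with just-injective (trans (sym du≡) du≡′)
    ...     | refl = (dv , dv≡ , ≤-trans (x≤x+y dv (w-nonneg G v u (edge-sym G e)))
                                         (≤-trans du≤b (x≤x+y b (w-nonneg G u v e)))) , inj₂ pu≡v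
    budget-edge {u} {v} {b} (du , du≡ , du≤b) e within | no pu≢v
      with closed u du v tt du≡ (queue-empty u) (e , pu≢v) (≤-trans (+-monoˡ-≤ (w G u v) du≤b) within)
    ... | pv≡u with parent-label forest v u pv≡u
    ...   | du′ , du′≡ , dv≡ with just-injective (trans (sym du≡) du′≡)
    ...     | refl = (du + w G u v , dv≡ , +-monoˡ-≤ (w G u v) du≤b) , inj₁ pv≡u

    budget-walk : ∀ {u v b dd} → Within u b → Walk (Edge G) (w G) u v dd → b + dd ≤ t → Within v (b + dd)
    budget-walk {b = b} reach [] _ = subst (Within _) (sym (+-identityʳ b)) reach
    budget-walk {b = b} reach (_∷_ {u} {x} {d = dd} e ws) within =
      subst (Within _) (+-assoc b (w G u x) dd) (budget-walk next-reach ws within′)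
      where
      within′ : (b + w G u x) + dd ≤ t
      within′ = ≤-trans (≤-reflexive (+-assoc b (w G u x) dd)) within
      next-reach : Within x (b + w G u x)
      next-reach = proj₁ (budget-edge reach e (x+y≤z⇒x≤z _ (walk-nonneg G ws) within′))

module CycleDetection (G : Graph) (C : Cycle G) (s : Fin (n G)) where
  open CycleArcs G C
  open CycleLinks G C
  open HBD G s (weight G C)

  forward-budget : ∀ D α γ β → D ≤ β → (D + α) + γ ≤ α + (γ + β)
  forward-budget D α γ β D≤β = ≤-trans
    (≤-reflexive (trans (cong (_+ γ) (+-comm D α)) (trans (+-assoc α D γ) (cong (α +_) (+-comm D γ)))))
    (+-monoʳ-≤ α (+-monoʳ-≤ γ D≤β))

  backward-budget : ∀ D α γ β → D ≤ α → (D + β) + γ ≤ α + (γ + β)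
  backward-budget D α γ β D≤α =
    ≤-trans (≤-reflexive (trans (+-assoc D β γ) (cong (D +_) (+-comm β γ)))) (+-monoˡ-≤ (γ + β) D≤α)

  module _ (ex : Exhausted) where
    open Exhausted ex
    open Exhaustion ex

    -- The edge from q = i + a to q + 1 is reachable from c_i both ways round:
    -- forwards along the arc α of length a, or backwards along the arc β of
    -- length b; since w(C) = α + (γ + β), a start within D suffices for the
    -- forward way when D ≤ β and for the backward way when D ≤ α.
    module AroundEdge (i : Fin k) (a b : ℕ) (a+1+b≡k : a ℕ.+ suc b ≡ k) where
      q = advance i a
      α = arc i a
      γ = cw q
      β = arc (next q) b

      split : weight G C ≡ α + (γ + β)
      split = weight-split i a b a+1+b≡k

      forward : ∀ {D} → Within (c C i) D → D ≤ β → Linked par (c C q) (c C (next q))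
      forward {D} reach-i D≤β = proj₂ (budget-edge reach-q (c-edge C q) within-γ)
        where
        within-γ : (D + α) + γ ≤ weight G C
        within-γ = ≤-trans (forward-budget D α γ β D≤β) (≤-reflexive (sym split))
        reach-q : Within (c C q) (D + α)
        reach-q = budget-walk reach-i (arcG i a) (x+y≤z⇒x≤z (D + α) (cw-nonneg q) within-γ)

      backward : ∀ {D} → Within (c C i) D → D ≤ α → Linked par (c C q) (c C (next q))
      backward {D} reach-i D≤α = swap (proj₂ (budget-edge reach-next (edge-sym G (c-edge C q)) within))
        where
        within-γ : (D + β) + γ ≤ weight G C
        within-γ = ≤-trans (backward-budget D α γ β D≤α) (≤-reflexive (sym split))
        back : Walk (Edge G) (w G) (c C i) (c C (next q)) β
        back = subst (λ z → Walk (Edge G) (w G) (c C z) (c C (next q)) β) (full-turn i a b a+1+b≡k)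
                     (RevG.reverse (arcG (next q) b))
        reach-next : Within (c C (next q)) (D + β)
        reach-next = budget-walk reach-i back (x+y≤z⇒x≤z (D + β) (cw-nonneg q) within-γ)
        within : (D + β) + w G (c C (next q)) (c C q) ≤ weight G C
        within = subst (λ z → (D + β) + z ≤ weight G C) (w-sym G (c C q) (c C (next q))) within-γ

    -- If c_i is reached within D ≤ dist_C(i, j), then every edge of C is a
    -- parent link, because j lies on one of the two arcs around that edge.
    cycle-edge-linked : ∀ {i j D dC} → Within (c C i) D → DistC G C i j dC → D ≤ dC →
                        ∀ q → Linked par (c C q) (c C (next q))
    cycle-edge-linked {i} {j} {D} reach-i dist D≤dC q with advance-onto i q
    ... | a , a<k , refl with remaining-steps a<k
    ...   | b , a+1+b≡k with distC-≤-one-arc a b a+1+b≡k dist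
    ...     | inj₁ dC≤α = AroundEdge.backward i a b a+1+b≡k reach-i (≤-trans D≤dC dC≤α)
    ...     | inj₂ dC≤β = AroundEdge.forward i a b a+1+b≡k reach-i (≤-trans D≤dC dC≤β)

  never-exhausted : ∀ i dGx → DistG G s (c C i) dGx → ∀ j dCxv → DistC G C i j dCxv → dGx ≤ dCxv → ¬ Exhausted
  never-exhausted i dGx distG j dCxv distC dGx≤dCxv ex =
    no-linked-cycle par (rank forest) (parent-rank forest) (cycle-edge-linked ex reach-x distC dGx≤dCxv)
    where
    open Exhausted ex
    open Exhaustion ex
    reach-x : Within (c C i) dGx
    reach-x = subst (Within (c C i)) (+-identityˡ dGx)
                (budget-walk within-source (proj₁ distG)
                  (≤-trans (≤-reflexive (+-identityˡ dGx)) (≤-trans dGx≤dCxv (distC-≤-weight distC))))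

open CycleArcs using (weight-nonneg)
open CycleDetection using (never-exhausted)

corollary2 : (G : Graph) (s : Fin (n G)) (C : Cycle G)
    (i : Fin (len (m C))) (dGx : ℚ) → DistG G s (c C i) dGx → 0ℚ < dGx →
    (j : Fin (len (m C))) (dCxv : ℚ) → DistC G C i j dCxv → dGx ≤ dCxv →
    Σ ℚ (λ t → 0ℚ ≤ t × t ≤ weight G C × Detects G s t)
corollary2 G s C i dGx distG _ j dCxv distC dGx≤dCxv =
  weight G C , weight-nonneg G C , ≤-refl ,
  HBD.detects-unless-exhausted G s (weight G C) (never-exhausted G C s i dGx distG j dCxv distC dGx≤dCxv)
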